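{- The class of doubly ordered frames is not modally definable: there is no set of formulas of the bimodal language (with modalities interpreted by $\leq_1$ and $\leq_2$) whose class of valid frames is exactly the class of doubly ordered frames.
   Context: Frames here are structures $\langle X, R_1, R_2\rangle$ with $R_1,R_2$ binary relations on a set $X$, used as Kripke frames for a modal language with two modal operators, the $i$-th interpreted by $R_i$. A class of such frames is modally definable if it is the class of all frames validating some set of modal formulas. A doubly ordered frame is such a structure $\langle X,\leq_1,\leq_2\rangle$ where $\leq_1,\leq_2$ are quasiorders (reflexive, transitive) on $X$ such that $x\leq_1 y$ and $x\leq_2 y$ together imply $x=y$ for all $x,y\in X$. -}

module Defs where

open import Data.Nat using (ℕ)
open import Data.Empty using (⊥)
open import Data.Product using (Σ; _×_)
open import Level using (0ℓ)
open import Relation.Binary.Core using (Rel)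
open import Relation.Binary.Structures using (IsPreorder)
open import Relation.Binary.PropositionalEquality using (_≡_)
open import Function.Bundles using (_⇔_)

-- Bimodal formulas: propositional variables indexed by ℕ, falsum,
-- implication and two boxes (other connectives are the usual abbreviations).
data Formula : Set where
  var  : ℕ → Formula
  ⊥'   : Formula
  _⇒_  : Formula → Formula → Formula
  □₁   : Formula → Formula
  □₂   : Formula → Formula

record Frame : Set₁ where
  field
    Carrier : Set
    R₁ : Rel Carrier 0ℓ
    R₂ : Rel Carrier 0ℓ
open Frame public

Valuation : Frame → Set₁
Valuation F = ℕ → Carrier F → Set

Sat : (F : Frame) → Valuation F → Carrier F → Formula → Set
Sat F V x (var n)  = V n x
Sat F V x ⊥'       = ⊥
Sat F V x (φ ⇒ ψ)  = Sat F V x φ → Sat F V x ψ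
Sat F V x (□₁ φ)   = ∀ y → R₁ F x y → Sat F V y φ
Sat F V x (□₂ φ)   = ∀ y → R₂ F x y → Sat F V y φ

ValidIn : Frame → Formula → Set₁
ValidIn F φ = (V : Valuation F) → (x : Carrier F) → Sat F V x φ

FormulaSet : Set₁
FormulaSet = Formula → Set

ValidatesAll : Frame → FormulaSet → Set₁
ValidatesAll F Γ = (φ : Formula) → Γ φ → ValidIn F φ

FrameClass : Set₂
FrameClass = Frame → Set₁

ModallyDefinable : FrameClass → Set₁
ModallyDefinable K = Σ FormulaSet λ Γ → (F : Frame) → (K F ⇔ ValidatesAll F Γ)

record DoublyOrdered (F : Frame) : Set₁ where
  field
    quasi₁ : IsPreorder _≡_ (R₁ F)
    quasi₂ : IsPreorder _≡_ (R₂ F)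
    antisym : ∀ x y → R₁ F x y → R₂ F x y → x ≡ y

module Submission where

-- Modal validity is reflected along surjective bounded morphisms (the
-- "p-morphic image" preservation theorem), so every modally definable class
-- is closed under surjective bounded morphic images.  It therefore suffices
-- to exhibit a doubly ordered frame with a non-doubly-ordered image.
--
-- Then comes the counterexample: the frame
-- on Bool × Bool whose two relations are the kernels of the second projection
-- and of xor (two equivalence relations meeting only in the diagonal) maps by
-- the first projection onto the two-point frame in which both relations are
-- total; the latter relates two distinct points by both relations, so it is
-- not doubly ordered.

open import Defs
open import Data.Bool using (Bool; true; false; _xor_)
open import Data.Bool.Properties using (xor-assoc; xor-comm; xor-same)
open import Data.Product using (Σ; _×_; _,_; proj₁; proj₂)
open import Data.Unit using (⊤; tt)
open import Function.Bundles using (Equivalence)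
open import Relation.Binary.Structures using (IsPreorder)
open import Relation.Binary.PropositionalEquality
  using (_≡_; refl; sym; trans; cong; isEquivalence; module ≡-Reasoning)
open import Relation.Nullary using (¬_)

record BoundedMorphism (F G : Frame) : Set where
  field
    map    : Carrier F → Carrier G
    forth₁ : ∀ {x y} → R₁ F x y → R₁ G (map x) (map y)
    forth₂ : ∀ {x y} → R₂ F x y → R₂ G (map x) (map y)
    back₁  : ∀ {x v} → R₁ G (map x) v → Σ (Carrier F) λ y → R₁ F x y × map y ≡ v
    back₂  : ∀ {x v} → R₂ G (map x) v → Σ (Carrier F) λ y → R₂ F x y × map y ≡ v

module _ {F G : Frame} (f : BoundedMorphism F G) where
  open BoundedMorphism f

  pullback : Valuation G → Valuation F
  pullback V n x = V n (map x)

  preserve : ∀ V x φ → Sat F (pullback V) x φ → Sat G V (map x) φ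
  reflect  : ∀ V x φ → Sat G V (map x) φ → Sat F (pullback V) x φ

  preserve V x (var n) s = s
  preserve V x ⊥'      s = s
  preserve V x (φ ⇒ ψ) s = λ t → preserve V x ψ (s (reflect V x φ t))
  preserve V x (□₁ φ)  s v xRv with back₁ xRv
  ... | y , xRy , refl = preserve V y φ (s y xRy)
  preserve V x (□₂ φ)  s v xRv with back₂ xRv
  ... | y , xRy , refl = preserve V y φ (s y xRy)

  reflect V x (var n) s = s
  reflect V x ⊥'      s = s
  reflect V x (φ ⇒ ψ) s = λ t → reflect V x ψ (s (preserve V x φ t))
  reflect V x (□₁ φ)  s y xRy = reflect V y φ (s (map y) (forth₁ xRy))
  reflect V x (□₂ φ)  s y xRy = reflect V y φ (s (map y) (forth₂ xRy))

  validity-image : (∀ v → Σ (Carrier F) λ x → map x ≡ v) →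
                   ∀ φ → ValidIn F φ → ValidIn G φ
  validity-image surj φ valid V v with surj v
  ... | x , refl = preserve V x φ (valid (pullback V) x)

definable-image-closed : ∀ {K F G} → ModallyDefinable K →
  (f : BoundedMorphism F G) →
  (∀ v → Σ (Carrier F) λ x → BoundedMorphism.map f x ≡ v) →
  K F → K G
definable-image-closed {F = F} {G} (Γ , defines) f surj KF =
  Equivalence.from (defines G) λ φ φ∈Γ →
    validity-image f surj φ (Equivalence.to (defines F) KF φ φ∈Γ)

kernel-isPreorder : ∀ {A B : Set} (h : A → B) →
                    IsPreorder _≡_ (λ x y → h x ≡ h y)
kernel-isPreorder h = record
  { isEquivalence = isEquivalence
  ; reflexive     = cong h
  ; trans         = trans
  }

xor-cancelˡ : ∀ c d → c xor (c xor d) ≡ d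
xor-cancelˡ c d = begin
  c xor (c xor d)  ≡⟨ sym (xor-assoc c c d) ⟩
  (c xor c) xor d  ≡⟨ cong (_xor d) (xor-same c) ⟩
  d                ∎
  where open ≡-Reasoning

parity : Bool × Bool → Bool
parity (a , b) = a xor b

Square : Frame
Square = record
  { Carrier = Bool × Bool
  ; R₁      = λ p q → proj₂ p ≡ proj₂ q
  ; R₂      = λ p q → parity p ≡ parity q
  }

-- A pair is determined by its second coordinate and its parity, so the two
-- kernels meet only in the diagonal.
square-doublyOrdered : DoublyOrdered Square
square-doublyOrdered = record
  { quasi₁  = kernel-isPreorder proj₂
  ; quasi₂  = kernel-isPreorder parity
  ; antisym = λ { (a , b) (a′ , .b) refl sameSum → cong (_, b) (first-determined sameSum) }
  }
  where
  first-determined : ∀ {a a′ b} → a xor b ≡ a′ xor b → a ≡ a′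
  first-determined {a} {a′} {b} sameSum = begin
    a                ≡⟨ sym (xor-cancelˡ b a) ⟩
    b xor (b xor a)  ≡⟨ cong (b xor_) (trans (xor-comm b a) (trans sameSum (xor-comm a′ b))) ⟩
    b xor (b xor a′) ≡⟨ xor-cancelˡ b a′ ⟩
    a′               ∎
    where open ≡-Reasoning

Cluster : Frame
Cluster = record { Carrier = Bool ; R₁ = λ _ _ → ⊤ ; R₂ = λ _ _ → ⊤ }

cluster-not-doublyOrdered : ¬ DoublyOrdered Cluster
cluster-not-doublyOrdered d with DoublyOrdered.antisym d true false tt tt
... | ()

-- The first projection is a bounded morphism from Square onto Cluster: every
-- first coordinate c is reached within the R₁-class of (a , b) by (c , b) and
-- within its R₂-class by (c , c xor (a xor b)).
projection : BoundedMorphism Square Cluster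
projection = record
  { map    = proj₁
  ; forth₁ = λ _ → tt
  ; forth₂ = λ _ → tt
  ; back₁  = λ { {a , b} {c} _ → (c , b) , refl , refl }
  ; back₂  = λ { {a , b} {c} _ → (c , c xor (a xor b)) , sym (xor-cancelˡ c (a xor b)) , refl }
  }

projection-surjective : ∀ c → Σ (Bool × Bool) λ p → proj₁ p ≡ c
projection-surjective c = (c , false) , refl

mainTheorem2 : ¬ ModallyDefinable DoublyOrdered
mainTheorem2 definable =
  cluster-not-doublyOrdered
    (definable-image-closed definable projection projection-surjective
                            square-doublyOrdered)
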